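{- For any integers $\Delta_1,\Delta_2$ with $\Delta_2>\Delta_1>1$, there exists a temporal graph $\mathcal G$ on $5$ vertices which is not a $(\Delta_1,\Delta_2)$-cluster temporal graph but such that $\mathcal G[S]$ is a $(\Delta_1,\Delta_2)$-cluster temporal graph for every set $S$ of at most $4$ vertices of $\mathcal G$.
   Context: A temporal graph $\mathcal G=(G,\mathcal T)$ consists of a finite static undirected graph $G=(V,E)$ and a function $\mathcal T:E\to 2^{\mathbb Z^+}\setminus\{\emptyset\}$ (finite sets) giving the times at which each edge appears; its time-edges are $\mathcal E(\mathcal G)=\{(e,t):e\in E,\ t\in\mathcal T(e)\}$ and its lifetime is $T(\mathcal G)=\max\{t:(e,t)\in\mathcal E(\mathcal G)\}$. An interval $[a,b]$ means the integer set $\{a,\dots,b\}$. An edge $e$ is $\Delta_1$-dense in $[a,b]$ if for every $\tau\in[a,\max\{a,b-\Delta_1+1\}]$ there is $t\in\mathcal T(e)$ with $\tau\le t\le \tau+\Delta_1-1$. A template is a pair $(X,[a,b])$ with $X$ a vertex set. Templates $(X,[a,b])$, $(Y,[c,d])$ are $\Delta_2$-independent if $X\cap Y=\emptyset$ or $|s-t|\ge\Delta_2$ for all $s\in[a,b]$, $t\in[c,d]$. $\mathcal G$ realises a collection $\{(X_i,[a_i,b_i])\}_i$ of pairwise $\Delta_2$-independent templates with $1\le a_i\le b_i\le T(\mathcal G)$ if every time-edge $(xy,t)$ has some $i$ with $x,y\in X_i$, $t\in[a_i,b_i]$, and for every $i$ and distinct $x,y\in X_i$, $xy$ is an edge that is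 $\Delta_1$-dense in $[a_i,b_i]$. $\mathcal G$ is a $(\Delta_1,\Delta_2)$-cluster temporal graph if it realises some such collection. For a vertex set $A$, $\mathcal G[A]$ is the temporal graph on $A$ with the time-edges of $\mathcal G$ having both endpoints in $A$. -}

module Defs where

open import Data.Nat using (ℕ; zero; suc; _+_; _∸_; _≤_; _<_; _⊔_; ∣_-_∣)
open import Data.Bool using (Bool; true; false; if_then_else_; _∧_)
open import Data.Fin using (Fin)
open import Data.Fin.Subset using (Subset; _∈_; _⊆_; ⊤)
open import Data.Vec using (lookup)
open import Data.List using (List; []; foldr; allFin; map)
import Data.List.Membership.Propositional as LM
open import Data.Product using (Σ; ∃; _×_; _,_)
open import Data.Sum using (_⊎_)
open import Relation.Nullary using (¬_)
open import Relation.Binary.PropositionalEquality using (_≡_; _≢_)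

-- A temporal graph on the vertex set Fin n.  times x y is the (finite) set of
-- times at which the edge xy appears, given as a list; xy is an edge of the
-- underlying static graph iff this list is nonempty.
record TemporalGraph (n : ℕ) : Set where
  field
    times  : Fin n → Fin n → List ℕ
    sym    : ∀ x y → times x y ≡ times y x
    noLoop : ∀ x → times x x ≡ []
    pos    : ∀ x y t → t LM.∈ times x y → 1 ≤ t
open TemporalGraph public

TimeEdge : ∀ {n} → TemporalGraph n → Fin n → Fin n → ℕ → Set
TimeEdge G x y t = t LM.∈ times G x y

IsEdge : ∀ {n} → TemporalGraph n → Fin n → Fin n → Set
IsEdge G x y = times G x y ≢ []

maxList : List ℕ → ℕ
maxList = foldr _⊔_ 0

-- Lifetime of G[A]: the largest time of a time-edge with both endpoints in A
-- (0 if there is none).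
lifetimeOn : ∀ {n} → TemporalGraph n → Subset n → ℕ
lifetimeOn {n} G A =
  maxList (map (λ x → maxList (map (λ y →
    if lookup A x ∧ lookup A y then maxList (times G x y) else 0)
    (allFin n))) (allFin n))

_∈[_,_] : ℕ → ℕ → ℕ → Set
t ∈[ a , b ] = a ≤ t × t ≤ b

Dense : ∀ {n} → ℕ → TemporalGraph n → Fin n → Fin n → ℕ → ℕ → Set
Dense Δ₁ G x y a b =
  ∀ τ → τ ∈[ a , a ⊔ (b + 1 ∸ Δ₁) ] →
    ∃ λ t → TimeEdge G x y t × τ ≤ t × t ≤ τ + Δ₁ ∸ 1

record Template (n : ℕ) : Set where
  constructor template
  field
    verts : Subset n
    start : ℕ
    end   : ℕ
open Template public

Disjoint : ∀ {n} → Subset n → Subset n → Set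
Disjoint X Y = ∀ v → ¬ (v ∈ X × v ∈ Y)

Independent : ∀ {n} → ℕ → Template n → Template n → Set
Independent Δ₂ P Q =
  Disjoint (verts P) (verts Q) ⊎
  (∀ s t → s ∈[ start P , end P ] → t ∈[ start Q , end Q ] → Δ₂ ≤ ∣ s - t ∣)

RealisesOn : ∀ {n} → ℕ → ℕ → TemporalGraph n → Subset n →
             (k : ℕ) → (Fin k → Template n) → Set
RealisesOn Δ₁ Δ₂ G A k tpl =
  (∀ i → verts (tpl i) ⊆ A) ×
  (∀ i → 1 ≤ start (tpl i) × start (tpl i) ≤ end (tpl i) × end (tpl i) ≤ lifetimeOn G A) ×
  (∀ i j → i ≢ j → Independent Δ₂ (tpl i) (tpl j)) ×
  (∀ x y t → x ∈ A → y ∈ A → TimeEdge G x y t →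
     ∃ λ i → x ∈ verts (tpl i) × y ∈ verts (tpl i) × t ∈[ start (tpl i) , end (tpl i) ]) ×
  (∀ i x y → x ∈ verts (tpl i) → y ∈ verts (tpl i) → x ≢ y →
     IsEdge G x y × Dense Δ₁ G x y (start (tpl i)) (end (tpl i)))

IsClusterOn : ∀ {n} → ℕ → ℕ → TemporalGraph n → Subset n → Set
IsClusterOn Δ₁ Δ₂ G A = ∃ λ k → ∃ λ (tpl : Fin k → Template _) → RealisesOn Δ₁ Δ₂ G A k tpl

IsCluster : ∀ {n} → ℕ → ℕ → TemporalGraph n → Set
IsCluster Δ₁ Δ₂ G = IsClusterOn Δ₁ Δ₂ G ⊤

-- The graph is a bowtie: triangles 012 and 034 glued at 0, with 01 and 02 at
-- time 1, 12 at time 2, 34 at time 1 + Δ₂ and 03 and 04 at time 2 + Δ₂.  In any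
-- realisation the templates covering 01 and 12 share vertex 1 at times less
-- than Δ₂ apart, so they coincide; likewise for 34 and 03; and these two
-- templates share 0 at times 2 and 1 + Δ₂, so a single template contains the
-- non-adjacent vertices 1 and 3.  Deleting any vertex v breaks this chain: the
-- two triangles minus v, the left one ending at time 1 when v ∈ {1,2} and the
-- right one starting at time 2 + Δ₂ when v ∈ {3,4}, are Δ₂-independent (and
-- disjoint when v = 0).  Such templates are built without regard to the lifetime
-- of G[S] and then trimmed to it.

module Submission where

open import Defs
open import Data.Nat using (ℕ; suc; _+_; _∸_; _≤_; _<_; _⊓_; ∣_-_∣; z≤n; s≤s; _≤?_)
open import Data.Nat.Properties hiding (_≟_)
open import Data.Bool using (true; if_then_else_; _∧_)
open import Data.Fin using (Fin; zero; suc; _≟_)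
open import Data.Fin.Subset using (Subset; _∈_; _∉_; _⊆_; _∩_; ∁; ⁅_⁆; ⊥; ∣_∣; inside; outside)
open import Data.Fin.Subset.Properties using (p∩q⊆p; p∩q⊆q; x∈p∩q⁺; ∉⊥; ⊥⊆; x∉p⇒x∈∁p; x∈⁅y⁆⇒x≡y; ∈⊤)
open import Data.Vec using ([]; _∷_; here; there; lookup)
open import Data.Vec.Properties using ([]=⇒lookup)
open import Data.List using (List; []; _∷_; map; allFin)
open import Data.List.Relation.Unary.Any using (here; there)
open import Data.List.Relation.Unary.Any.Properties using (¬Any[])
import Data.List.Membership.Propositional as List
open import Data.List.Membership.Propositional.Properties using (∈-map⁺; ∈-allFin)
open import Data.Product using (Σ; ∃; ∃₂; _×_; _,_; proj₁; proj₂)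
open import Data.List.Relation.Unary.All as All using (All; []; _∷_)
open import Data.Sum using (_⊎_; inj₁; inj₂; swap)
open import Relation.Nullary using (¬_; yes; no; Dec; contradiction)
open import Relation.Nullary.Decidable using (_×-dec_; _⊎-dec_)
open import Relation.Binary.PropositionalEquality as ≡ using (_≡_; _≢_; refl; cong; subst)

private
  variable
    n : ℕ

Joins : Fin n → Fin n → Fin n → Fin n → Set
Joins u v x y = (u ≡ x × v ≡ y) ⊎ (u ≡ y × v ≡ x)

joins? : (u v x y : Fin n) → Dec (Joins u v x y)
joins? u v x y = (u ≟ x ×-dec v ≟ y) ⊎-dec (u ≟ y ×-dec v ≟ x)

timesOf : List (Fin n × Fin n × ℕ) → Fin n → Fin n → List ℕ
timesOf [] x y = []
timesOf ((u , v , t) ∷ ls) x y with joins? u v x y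
... | yes _ = t ∷ timesOf ls x y
... | no  _ = timesOf ls x y

timesOf-sym : ∀ (ls : List (Fin n × Fin n × ℕ)) x y → timesOf ls x y ≡ timesOf ls y x
timesOf-sym [] x y = refl
timesOf-sym ((u , v , t) ∷ ls) x y with joins? u v x y | joins? u v y x
... | yes _ | yes _ = cong (t ∷_) (timesOf-sym ls x y)
... | no  _ | no  _ = timesOf-sym ls x y
... | yes j | no ¬j = contradiction (swap j) ¬j
... | no ¬j | yes j = contradiction (swap j) ¬j

timesOf-irrefl : ∀ (ls : List (Fin n × Fin n × ℕ)) x → All (λ (u , v , _) → u ≢ v) ls →
                 timesOf ls x x ≡ []
timesOf-irrefl [] x _ = refl
timesOf-irrefl ((u , v , t) ∷ ls) x (u≢v ∷ ls≢) with joins? u v x x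
... | yes (inj₁ (refl , refl)) = contradiction refl u≢v
... | yes (inj₂ (refl , refl)) = contradiction refl u≢v
... | no  _ = timesOf-irrefl ls x ls≢

∈timesOf⁻ : ∀ (ls : List (Fin n × Fin n × ℕ)) {x y t} → t List.∈ timesOf ls x y →
            ∃₂ λ u v → (u , v , t) List.∈ ls × Joins u v x y
∈timesOf⁻ ((u , v , s) ∷ ls) {x} {y} e with joins? u v x y | e
... | yes j | here refl = u , v , here refl , j
... | yes _ | there e′ = let u′ , v′ , l , j = ∈timesOf⁻ ls e′ in u′ , v′ , there l , j
... | no  _ | e′ = let u′ , v′ , l , j = ∈timesOf⁻ ls e′ in u′ , v′ , there l , j

linkGraph : (ls : List (Fin n × Fin n × ℕ)) → All (λ (u , v , t) → u ≢ v × 1 ≤ t) ls →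
            TemporalGraph n
linkGraph ls valid = record
  { times  = timesOf ls
  ; sym    = timesOf-sym ls
  ; noLoop = λ x → timesOf-irrefl ls x (All.map proj₁ valid)
  ; pos    = λ x y t e → let _ , _ , l , _ = ∈timesOf⁻ ls e in proj₂ (All.lookup valid l)
  }

∈⇒≤maxList : ∀ {t xs} → t List.∈ xs → t ≤ maxList xs
∈⇒≤maxList {xs = x ∷ _} (here refl) = m≤m⊔n x _
∈⇒≤maxList {xs = x ∷ _} (there t∈xs) = ≤-trans (∈⇒≤maxList t∈xs) (m≤n⊔m x _)

timeEdge≤lifetimeOn : ∀ (G : TemporalGraph n) S {x y t} → x ∈ S → y ∈ S → TimeEdge G x y t →
                      t ≤ lifetimeOn G S
timeEdge≤lifetimeOn {n} G S {x} {y} {t} x∈S y∈S e = begin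
  t                     ≤⟨ ∈⇒≤maxList e ⟩
  maxList (times G x y) ≡⟨ cong (λ b → if b then maxList (times G x y) else 0) (≡.sym both) ⟩
  row x y               ≤⟨ ∈⇒≤maxList (∈-map⁺ (row x) (∈-allFin y)) ⟩
  rowMax x              ≤⟨ ∈⇒≤maxList (∈-map⁺ rowMax (∈-allFin x)) ⟩
  lifetimeOn G S        ∎
  where
  open ≤-Reasoning
  row : Fin n → Fin n → ℕ
  row x y = if lookup S x ∧ lookup S y then maxList (times G x y) else 0
  rowMax : Fin n → ℕ
  rowMax x = maxList (map (row x) (allFin n))
  both : lookup S x ∧ lookup S y ≡ true
  both rewrite []=⇒lookup x∈S | []=⇒lookup y∈S = refl

-- For an interval of length at most two and Δ₁ ≥ 2 the only window to check is
-- the one starting at a.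
Dense-short : ∀ {Δ₁} (G : TemporalGraph n) x y {a b t} → 1 < Δ₁ → b ≤ suc a →
              TimeEdge G x y t → a ≤ t → t ≤ suc a → Dense Δ₁ G x y a b
Dense-short {Δ₁ = Δ₁} G x y {a} {b} {t} 1<Δ₁ b≤1+a e a≤t t≤1+a τ (a≤τ , τ≤) =
  t , e , subst (_≤ t) (≡.sym τ≡a) a≤t , subst (λ τ → t ≤ τ + Δ₁ ∸ 1) (≡.sym τ≡a) t≤a+Δ₁-1
  where
  open ≤-Reasoning
  lastWindow≤a : b + 1 ∸ Δ₁ ≤ a
  lastWindow≤a = begin
    b + 1 ∸ Δ₁ ≤⟨ ∸-monoʳ-≤ (b + 1) 1<Δ₁ ⟩
    b + 1 ∸ 2  ≡⟨ cong (_∸ 2) (+-comm b 1) ⟩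
    b ∸ 1      ≤⟨ ∸-monoˡ-≤ 1 b≤1+a ⟩
    a          ∎
  τ≡a : _ ≡ a
  τ≡a = ≤-antisym (≤-trans τ≤ (≤-reflexive (m≥n⇒m⊔n≡m lastWindow≤a))) a≤τ
  t≤a+Δ₁-1 : t ≤ a + Δ₁ ∸ 1
  t≤a+Δ₁-1 = begin
    t            ≤⟨ t≤1+a ⟩
    suc a        ≡⟨ +-comm 1 a ⟩
    a + 1        ≤⟨ +-monoʳ-≤ a (∸-monoˡ-≤ 1 1<Δ₁) ⟩
    a + (Δ₁ ∸ 1) ≡⟨ +-∸-assoc a (<⇒≤ 1<Δ₁) ⟨
    a + Δ₁ ∸ 1   ∎

Dense-shrink : ∀ {Δ₁} (G : TemporalGraph n) {x y a b b′} → b′ ≤ b →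
               Dense Δ₁ G x y a b → Dense Δ₁ G x y a b′
Dense-shrink {Δ₁ = Δ₁} G {a = a} b′≤b dense τ (a≤τ , τ≤) =
  dense τ (a≤τ , ≤-trans τ≤ (⊔-monoʳ-≤ a (∸-monoˡ-≤ Δ₁ (+-monoˡ-≤ 1 b′≤b))))

TimeEdge⇒IsEdge : ∀ (G : TemporalGraph n) x y {t} → TimeEdge G x y t → IsEdge G x y
TimeEdge⇒IsEdge G x y e none = ¬Any[] (subst (_ List.∈_) none e)

_⊑_ : Template n → Template n → Set
P ⊑ Q = verts P ⊆ verts Q × start Q ≤ start P × end P ≤ end Q

Independent-antitone : ∀ {Δ₂} {P P′ Q Q′ : Template n} → P ⊑ P′ → Q ⊑ Q′ →
                       Independent Δ₂ P′ Q′ → Independent Δ₂ P Q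
Independent-antitone (X⊆ , _ , _) (Y⊆ , _ , _) (inj₁ disjoint) =
  inj₁ λ v (v∈X , v∈Y) → disjoint v (X⊆ v∈X , Y⊆ v∈Y)
Independent-antitone (_ , a′≤a , b≤b′) (_ , c′≤c , d≤d′) (inj₂ far) =
  inj₂ λ s t (a≤s , s≤b) (c≤t , t≤d) →
    far s t (≤-trans a′≤a a≤s , ≤-trans s≤b b≤b′) (≤-trans c′≤c c≤t , ≤-trans t≤d d≤d′)

Independent-sym : ∀ {Δ₂} {P Q : Template n} → Independent Δ₂ P Q → Independent Δ₂ Q P
Independent-sym (inj₁ disjoint) = inj₁ λ v (v∈Y , v∈X) → disjoint v (v∈X , v∈Y)
Independent-sym {Δ₂ = Δ₂} (inj₂ far) =
  inj₂ λ s t s∈ t∈ → subst (Δ₂ ≤_) (∣-∣-comm t s) (far t s t∈ s∈)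

m+n≤o⇒n≤∣m-o∣ : ∀ m n {o} → m + n ≤ o → n ≤ ∣ m - o ∣
m+n≤o⇒n≤∣m-o∣ m n {o} m+n≤o = begin
  n         ≤⟨ m+n≤o⇒m≤o∸n n (subst (_≤ o) (+-comm m n) m+n≤o) ⟩
  o ∸ m     ≤⟨ m∸n≤∣m-n∣ o m ⟩
  ∣ o - m ∣ ≡⟨ ∣-∣-comm o m ⟩
  ∣ m - o ∣ ∎
  where open ≤-Reasoning

separated⇒Independent : ∀ {Δ₂} {P Q : Template n} → end P + Δ₂ ≤ start Q → Independent Δ₂ P Q
separated⇒Independent {Δ₂ = Δ₂} sep = inj₂ λ s t (_ , s≤b) (c≤t , _) →
  m+n≤o⇒n≤∣m-o∣ s Δ₂ (≤-trans (+-monoˡ-≤ Δ₂ s≤b) (≤-trans sep c≤t))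

pair-independent : ∀ {Δ₂} (P : Fin 2 → Template n) → Independent Δ₂ (P zero) (P (suc zero)) →
                   ∀ i j → i ≢ j → Independent Δ₂ (P i) (P j)
pair-independent P ind zero       zero       0≢0 = contradiction refl 0≢0
pair-independent P ind zero       (suc zero) _   = ind
pair-independent P ind (suc zero) zero       _   = Independent-sym ind
pair-independent P ind (suc zero) (suc zero) 1≢1 = contradiction refl 1≢1

m≤n<m+o⇒∣m-n∣<o : ∀ {m n o} → m ≤ n → n < m + o → ∣ m - n ∣ < o
m≤n<m+o⇒∣m-n∣<o {m} {n} {o} m≤n n<m+o = begin-strict
  ∣ m - n ∣   ≡⟨ m≤n⇒∣m-n∣≡n∸m m≤n ⟩
  n ∸ m       <⟨ ∸-monoˡ-< n<m+o m≤n ⟩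
  m + o ∸ m   ≡⟨ m+n∸m≡n m o ⟩
  o           ∎
  where open ≤-Reasoning

close⇒same-template : ∀ {Δ₂ k} {tpl : Fin k → Template n} →
                      (∀ i j → i ≢ j → Independent Δ₂ (tpl i) (tpl j)) →
                      ∀ {i j v s t} → v ∈ verts (tpl i) → v ∈ verts (tpl j) →
                      s ∈[ start (tpl i) , end (tpl i) ] → t ∈[ start (tpl j) , end (tpl j) ] →
                      ∣ s - t ∣ < Δ₂ → i ≡ j
close⇒same-template independent {i} {j} {v} {s} {t} v∈i v∈j s∈ t∈ close with i ≟ j
... | yes i≡j = i≡j
... | no  i≢j with independent i j i≢j
...   | inj₁ disjoint = contradiction (v∈i , v∈j) (disjoint v)
...   | inj₂ far      = contradiction (far s t s∈ t∈) (<⇒≱ close)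

Covers : Template n → Fin n → Fin n → ℕ → Set
Covers P x y t = x ∈ verts P × y ∈ verts P × t ∈[ start P , end P ]

DenseClique : ℕ → TemporalGraph n → Template n → Set
DenseClique Δ₁ G P = ∀ x y → x ∈ verts P → y ∈ verts P → x ≢ y →
                     IsEdge G x y × Dense Δ₁ G x y (start P) (end P)

Covers-sym : ∀ {P : Template n} {x y t} → Covers P x y t → Covers P y x t
Covers-sym (x∈ , y∈ , t∈) = y∈ , x∈ , t∈

-- What remains of RealisesOn once templates may stick out of S and past the
-- lifetime of G[S]; trimming the templates restores it.
record PreRealisesOn (Δ₁ Δ₂ : ℕ) (G : TemporalGraph n) (S : Subset n)
                     (k : ℕ) (tpl : Fin k → Template n) : Set where
  field
    start-positive : ∀ i → 1 ≤ start (tpl i)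
    independent    : ∀ i j → i ≢ j → Independent Δ₂ (tpl i) (tpl j)
    covering       : ∀ x y t → x ∈ S → y ∈ S → TimeEdge G x y t → ∃ λ i → Covers (tpl i) x y t
    dense          : ∀ i → DenseClique Δ₁ G (tpl i)

-- A template whose interval misses [1 , L] is replaced by the empty template
-- (⊥ , [1 , 1]), which keeps the index set unchanged.
trim : Subset n → ℕ → Template n → Template n
trim S L P with start P ≤? end P ⊓ L
... | yes _ = template (verts P ∩ S) (start P) (end P ⊓ L)
... | no  _ = template ⊥ 1 1

module _ (S : Subset n) (L : ℕ) where

  trim-⊆ : ∀ P → verts (trim S L P) ⊆ S
  trim-⊆ P with start P ≤? end P ⊓ L
  ... | yes _ = p∩q⊆q _ S
  ... | no  _ = ⊥⊆

  trim-bounds : ∀ P → 1 ≤ start P → 1 ≤ L →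
                let Q = trim S L P in 1 ≤ start Q × start Q ≤ end Q × end Q ≤ L
  trim-bounds P 1≤a 1≤L with start P ≤? end P ⊓ L
  ... | yes a≤b⊓L = 1≤a , a≤b⊓L , m⊓n≤n _ L
  ... | no  _     = ≤-refl , ≤-refl , 1≤L

  trim-independent : ∀ {Δ₂} P Q → Independent Δ₂ P Q → Independent Δ₂ (trim S L P) (trim S L Q)
  trim-independent P Q ind with start P ≤? end P ⊓ L | start Q ≤? end Q ⊓ L
  ... | yes _ | yes _ = Independent-antitone (p∩q⊆p _ S , ≤-refl , m⊓n≤m _ L)
                                             (p∩q⊆p _ S , ≤-refl , m⊓n≤m _ L) ind
  ... | no  _ | _     = inj₁ λ v (v∈⊥ , _) → ∉⊥ v∈⊥
  ... | yes _ | no _  = inj₁ λ v (_ , v∈⊥) → ∉⊥ v∈⊥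

  trim-covers : ∀ P {x y t} → x ∈ S → y ∈ S → t ≤ L → Covers P x y t → Covers (trim S L P) x y t
  trim-covers P x∈S y∈S t≤L (x∈P , y∈P , a≤t , t≤b) with start P ≤? end P ⊓ L
  ... | yes _    = x∈p∩q⁺ (x∈P , x∈S) , x∈p∩q⁺ (y∈P , y∈S) , a≤t , ⊓-glb t≤b t≤L
  ... | no a≰b⊓L = contradiction (≤-trans a≤t (⊓-glb t≤b t≤L)) a≰b⊓L

  trim-dense : ∀ {Δ₁} (G : TemporalGraph n) P → DenseClique Δ₁ G P → DenseClique Δ₁ G (trim S L P)
  trim-dense G P dense x y x∈ y∈ x≢y with start P ≤? end P ⊓ L
  ... | no _  = contradiction x∈ ∉⊥
  ... | yes _ with dense x y (p∩q⊆p _ S x∈) (p∩q⊆p _ S y∈) x≢y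
  ...   | edge , d = edge , Dense-shrink G (m⊓n≤m _ L) d

PreRealisesOn⇒IsClusterOn : ∀ {Δ₁ Δ₂} {G : TemporalGraph n} {S k tpl} →
                             PreRealisesOn Δ₁ Δ₂ G S k tpl → IsClusterOn Δ₁ Δ₂ G S
PreRealisesOn⇒IsClusterOn {G = G} {S} {k} {tpl} pre with 1 ≤? lifetimeOn G S
... | yes 1≤L =
  k , (λ i → trim S L (tpl i)) , (λ i → trim-⊆ S L (tpl i))
    , (λ i → trim-bounds S L (tpl i) (start-positive i) 1≤L)
    , (λ i j i≢j → trim-independent S L (tpl i) (tpl j) (independent i j i≢j))
    , (λ x y t x∈S y∈S e → let i , c = covering x y t x∈S y∈S e in
                            i , trim-covers S L (tpl i) x∈S y∈S (timeEdge≤lifetimeOn G S x∈S y∈S e) c)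
    , (λ i → trim-dense S L G (tpl i) (dense i))
  where
  open PreRealisesOn pre
  L : ℕ
  L = lifetimeOn G S
... | no 1≰L = 0 , (λ ()) , (λ ()) , (λ ()) , (λ ())
             , (λ x y t x∈S y∈S e →
                  contradiction (≤-trans (pos G x y t e) (timeEdge≤lifetimeOn G S x∈S y∈S e)) 1≰L)
             , (λ ())

missing-element : ∀ (p : Subset n) → ∣ p ∣ < n → ∃ λ x → x ∉ p
missing-element (outside ∷ p) _ = zero , λ ()
missing-element (inside ∷ p) (s≤s ∣p∣<n) with missing-element p ∣p∣<n
... | x , x∉p = suc x , λ { (there x∈p) → x∉p x∈p }

∉⇒⊆∁⁅⁆ : ∀ {p : Subset n} {x} → x ∉ p → p ⊆ ∁ ⁅ x ⁆
∉⇒⊆∁⁅⁆ {x = x} x∉p y∈p = x∉p⇒x∈∁p λ y∈⁅x⁆ → x∉p (subst (_∈ _) (x∈⁅y⁆⇒x≡y x y∈⁅x⁆) y∈p)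

pattern v0 = zero
pattern v1 = suc zero
pattern v2 = suc (suc zero)
pattern v3 = suc (suc (suc zero))
pattern v4 = suc (suc (suc (suc zero)))

module Bowtie (Δ₂ : ℕ) where

  links : List (Fin 5 × Fin 5 × ℕ)
  links = (v0 , v1 , 1) ∷ (v0 , v2 , 1) ∷ (v1 , v2 , 2)
        ∷ (v0 , v3 , 2 + Δ₂) ∷ (v0 , v4 , 2 + Δ₂) ∷ (v3 , v4 , 1 + Δ₂) ∷ []

  G : TemporalGraph 5
  G = linkGraph links (((λ ()) , s≤s z≤n) ∷ ((λ ()) , s≤s z≤n) ∷ ((λ ()) , s≤s z≤n)
                     ∷ ((λ ()) , s≤s z≤n) ∷ ((λ ()) , s≤s z≤n) ∷ ((λ ()) , s≤s z≤n) ∷ [])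

  not-cluster : ∀ Δ₁ → 1 < Δ₂ → ¬ IsCluster Δ₁ Δ₂ G
  not-cluster Δ₁ 1<Δ₂ (_ , tpl , _ , _ , independent , covering , dense)
    with covering v0 v1 1 ∈⊤ ∈⊤ (here refl)        | covering v1 v2 2 ∈⊤ ∈⊤ (here refl)
       | covering v0 v3 (2 + Δ₂) ∈⊤ ∈⊤ (here refl) | covering v3 v4 (1 + Δ₂) ∈⊤ ∈⊤ (here refl)
  ... | i , 0∈i , 1∈i , 1∈Iᵢ | j , 1∈j , _ , 2∈Iⱼ | k , 0∈k , 3∈k , 2+Δ₂∈Iₖ | l , 3∈l , _ , 1+Δ₂∈Iₗ
    with close⇒same-template independent 1∈i 1∈j 1∈Iᵢ 2∈Iⱼ 1<Δ₂
       | close⇒same-template independent 3∈l 3∈k 1+Δ₂∈Iₗ 2+Δ₂∈Iₖ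
           (m≤n<m+o⇒∣m-n∣<o (n≤1+n _) (s≤s (+-monoˡ-≤ Δ₂ 1<Δ₂)))
  ... | refl | refl
    with close⇒same-template independent 0∈i 0∈k 2∈Iⱼ 1+Δ₂∈Iₗ
           (m≤n<m+o⇒∣m-n∣<o (s≤s (<⇒≤ 1<Δ₂)) ≤-refl)
  ... | refl = proj₁ (dense i v1 v3 1∈i 3∈k (λ ())) refl

  left right : Subset 5
  left  = inside ∷ inside ∷ inside ∷ outside ∷ outside ∷ []
  right = inside ∷ outside ∷ outside ∷ inside ∷ inside ∷ []

  leftEnd : Fin 5 → ℕ
  leftEnd v1 = 1
  leftEnd v2 = 1
  leftEnd _  = 2

  rightStart : Fin 5 → ℕ
  rightStart v3 = 2 + Δ₂
  rightStart v4 = 2 + Δ₂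
  rightStart _  = 1 + Δ₂

  triangles : Fin 5 → Fin 2 → Template 5
  triangles v zero       = template (left ∩ ∁ ⁅ v ⁆) 1 (leftEnd v)
  triangles v (suc zero) = template (right ∩ ∁ ⁅ v ⁆) (rightStart v) (2 + Δ₂)

  leftEnd-range : ∀ v → leftEnd v ∈[ 1 , 2 ]
  leftEnd-range v0 = s≤s z≤n , ≤-refl
  leftEnd-range v1 = ≤-refl , s≤s z≤n
  leftEnd-range v2 = ≤-refl , s≤s z≤n
  leftEnd-range v3 = s≤s z≤n , ≤-refl
  leftEnd-range v4 = s≤s z≤n , ≤-refl

  rightStart-range : ∀ v → rightStart v ∈[ 1 + Δ₂ , 2 + Δ₂ ]
  rightStart-range v0 = ≤-refl , n≤1+n _
  rightStart-range v1 = ≤-refl , n≤1+n _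
  rightStart-range v2 = ≤-refl , n≤1+n _
  rightStart-range v3 = n≤1+n _ , ≤-refl
  rightStart-range v4 = n≤1+n _ , ≤-refl

  leftEnd-rim : ∀ v → v1 ∈ ∁ ⁅ v ⁆ → v2 ∈ ∁ ⁅ v ⁆ → leftEnd v ≡ 2
  leftEnd-rim v0 _ _ = refl
  leftEnd-rim v1 (there ()) _
  leftEnd-rim v2 _ (there (there ()))
  leftEnd-rim v3 _ _ = refl
  leftEnd-rim v4 _ _ = refl

  rightStart-rim : ∀ v → v3 ∈ ∁ ⁅ v ⁆ → v4 ∈ ∁ ⁅ v ⁆ → rightStart v ≡ 1 + Δ₂
  rightStart-rim v0 _ _ = refl
  rightStart-rim v1 _ _ = refl
  rightStart-rim v2 _ _ = refl
  rightStart-rim v3 (there (there (there ()))) _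
  rightStart-rim v4 _ (there (there (there (there ()))))

  triangles-independent : ∀ v → Independent Δ₂ (triangles v zero) (triangles v (suc zero))
  triangles-independent v0 = inj₁ λ where
    v0 (() , _)
    v1 (_ , there ())
    v2 (_ , there (there ()))
    v3 (there (there (there ())) , _)
    v4 (there (there (there (there ()))) , _)
  triangles-independent v1 = separated⇒Independent ≤-refl
  triangles-independent v2 = separated⇒Independent ≤-refl
  triangles-independent v3 = separated⇒Independent ≤-refl
  triangles-independent v4 = separated⇒Independent ≤-refl

  link-covered : ∀ {v x y t} → x ∈ ∁ ⁅ v ⁆ → y ∈ ∁ ⁅ v ⁆ → (x , y , t) List.∈ links →
                 ∃ λ i → Covers (triangles v i) x y t
  link-covered {v} x∈ y∈ (here refl) =
    zero , x∈p∩q⁺ (here , x∈) , x∈p∩q⁺ (there here , y∈) , ≤-refl , proj₁ (leftEnd-range v)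
  link-covered {v} x∈ y∈ (there (here refl)) =
    zero , x∈p∩q⁺ (here , x∈) , x∈p∩q⁺ (there (there here) , y∈) , ≤-refl , proj₁ (leftEnd-range v)
  link-covered {v} x∈ y∈ (there (there (here refl))) =
    zero , x∈p∩q⁺ (there here , x∈) , x∈p∩q⁺ (there (there here) , y∈)
         , s≤s z≤n , ≤-reflexive (≡.sym (leftEnd-rim v x∈ y∈))
  link-covered {v} x∈ y∈ (there (there (there (here refl)))) =
    suc zero , x∈p∩q⁺ (here , x∈) , x∈p∩q⁺ (there (there (there here)) , y∈)
             , proj₂ (rightStart-range v) , ≤-refl
  link-covered {v} x∈ y∈ (there (there (there (there (here refl))))) =
    suc zero , x∈p∩q⁺ (here , x∈) , x∈p∩q⁺ (there (there (there (there here))) , y∈)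
             , proj₂ (rightStart-range v) , ≤-refl
  link-covered {v} x∈ y∈ (there (there (there (there (there (here refl)))))) =
    suc zero , x∈p∩q⁺ (there (there (there here)) , x∈)
             , x∈p∩q⁺ (there (there (there (there here))) , y∈)
             , ≤-reflexive (rightStart-rim v x∈ y∈) , n≤1+n _

  triangles-covering : ∀ {v S} → S ⊆ ∁ ⁅ v ⁆ → ∀ x y t → x ∈ S → y ∈ S → TimeEdge G x y t →
                       ∃ λ i → Covers (triangles v i) x y t
  triangles-covering S⊆ x y t x∈S y∈S e with ∈timesOf⁻ links e
  ... | _ , _ , l , inj₁ (refl , refl) = link-covered (S⊆ x∈S) (S⊆ y∈S) l
  ... | _ , _ , l , inj₂ (refl , refl) =
    let i , c = link-covered (S⊆ y∈S) (S⊆ x∈S) l in i , Covers-sym c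

  left-linked : ∀ x y → x ∈ left → y ∈ left → x ≢ y → ∃ λ t → TimeEdge G x y t × t ∈[ 1 , 2 ]
  left-linked v0 v1 _ _ _ = 1 , here refl , ≤-refl , s≤s z≤n
  left-linked v0 v2 _ _ _ = 1 , here refl , ≤-refl , s≤s z≤n
  left-linked v1 v0 _ _ _ = 1 , here refl , ≤-refl , s≤s z≤n
  left-linked v1 v2 _ _ _ = 2 , here refl , s≤s z≤n , ≤-refl
  left-linked v2 v0 _ _ _ = 1 , here refl , ≤-refl , s≤s z≤n
  left-linked v2 v1 _ _ _ = 2 , here refl , s≤s z≤n , ≤-refl
  left-linked v0 v0 _ _ x≢x = contradiction refl x≢x
  left-linked v1 v1 _ _ x≢x = contradiction refl x≢x
  left-linked v2 v2 _ _ x≢x = contradiction refl x≢x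
  left-linked v3 _ (there (there (there ()))) _ _
  left-linked v4 _ (there (there (there (there ())))) _ _
  left-linked _ v3 _ (there (there (there ()))) _
  left-linked _ v4 _ (there (there (there (there ())))) _

  right-linked : ∀ v x y → x ∈ right ∩ ∁ ⁅ v ⁆ → y ∈ right ∩ ∁ ⁅ v ⁆ → x ≢ y →
                 ∃ λ t → TimeEdge G x y t × t ∈[ rightStart v , suc (rightStart v) ]
  right-linked v x y x∈ y∈ x≢y =
    linked x y (p∩q⊆p right _ x∈) (p∩q⊆p right _ y∈) (p∩q⊆q right _ x∈) (p∩q⊆q right _ y∈) x≢y
    where
    spoke : (2 + Δ₂) ∈[ rightStart v , suc (rightStart v) ]
    spoke = proj₂ (rightStart-range v) , s≤s (proj₁ (rightStart-range v))
    rim : v3 ∈ ∁ ⁅ v ⁆ → v4 ∈ ∁ ⁅ v ⁆ → (1 + Δ₂) ∈[ rightStart v , suc (rightStart v) ]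
    rim 3∈ 4∈ rewrite rightStart-rim v 3∈ 4∈ = ≤-refl , n≤1+n _
    linked : ∀ x y → x ∈ right → y ∈ right → x ∈ ∁ ⁅ v ⁆ → y ∈ ∁ ⁅ v ⁆ → x ≢ y →
             ∃ λ t → TimeEdge G x y t × t ∈[ rightStart v , suc (rightStart v) ]
    linked v0 v3 _ _ _ _ _ = 2 + Δ₂ , here refl , spoke
    linked v0 v4 _ _ _ _ _ = 2 + Δ₂ , here refl , spoke
    linked v3 v0 _ _ _ _ _ = 2 + Δ₂ , here refl , spoke
    linked v4 v0 _ _ _ _ _ = 2 + Δ₂ , here refl , spoke
    linked v3 v4 _ _ 3∈ 4∈ _ = 1 + Δ₂ , here refl , rim 3∈ 4∈
    linked v4 v3 _ _ 4∈ 3∈ _ = 1 + Δ₂ , here refl , rim 3∈ 4∈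
    linked v0 v0 _ _ _ _ x≢x = contradiction refl x≢x
    linked v3 v3 _ _ _ _ x≢x = contradiction refl x≢x
    linked v4 v4 _ _ _ _ x≢x = contradiction refl x≢x
    linked v1 _ (there ()) _ _ _ _
    linked v2 _ (there (there ())) _ _ _ _
    linked _ v1 _ (there ()) _ _ _
    linked _ v2 _ (there (there ())) _ _ _

  triangles-dense : ∀ {Δ₁} → 1 < Δ₁ → ∀ v i → DenseClique Δ₁ G (triangles v i)
  triangles-dense 1<Δ₁ v zero x y x∈ y∈ x≢y =
    let t , e , 1≤t , t≤2 = left-linked x y (p∩q⊆p left _ x∈) (p∩q⊆p left _ y∈) x≢y
    in TimeEdge⇒IsEdge G x y e , Dense-short G x y 1<Δ₁ (proj₂ (leftEnd-range v)) e 1≤t t≤2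
  triangles-dense 1<Δ₁ v (suc zero) x y x∈ y∈ x≢y =
    let t , e , a≤t , t≤1+a = right-linked v x y x∈ y∈ x≢y
    in TimeEdge⇒IsEdge G x y e
     , Dense-short G x y 1<Δ₁ (s≤s (proj₁ (rightStart-range v))) e a≤t t≤1+a

  triangles-preRealise : ∀ {Δ₁ v S} → 1 < Δ₁ → S ⊆ ∁ ⁅ v ⁆ →
                         PreRealisesOn Δ₁ Δ₂ G S 2 (triangles v)
  triangles-preRealise {v = v} 1<Δ₁ S⊆ = record
    { start-positive = λ { zero       → ≤-refl
                         ; (suc zero) → ≤-trans (s≤s z≤n) (proj₁ (rightStart-range v)) }
    ; independent    = pair-independent (triangles v) (triangles-independent v)
    ; covering       = triangles-covering S⊆
    ; dense          = triangles-dense 1<Δ₁ v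
    }

lemma14 : (Δ₁ Δ₂ : ℕ) → 1 < Δ₁ → Δ₁ < Δ₂ →
    Σ (TemporalGraph 5) (λ G →
      ¬ IsCluster Δ₁ Δ₂ G ×
      ((S : Subset 5) → ∣ S ∣ ≤ 4 → IsClusterOn Δ₁ Δ₂ G S))
lemma14 Δ₁ Δ₂ 1<Δ₁ Δ₁<Δ₂ = G , not-cluster Δ₁ (<-trans 1<Δ₁ Δ₁<Δ₂) , clusterOn-small
  where
  open Bowtie Δ₂
  clusterOn-small : (S : Subset 5) → ∣ S ∣ ≤ 4 → IsClusterOn Δ₁ Δ₂ G S
  clusterOn-small S ∣S∣≤4 =
    let v , v∉S = missing-element S (s≤s ∣S∣≤4)
    in PreRealisesOn⇒IsClusterOn (triangles-preRealise 1<Δ₁ (∉⇒⊆∁⁅⁆ v∉S))
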